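{- (i) $\mathrm{ex}_<(n,P_5^{1234})=\Theta(n)$, and (ii) $\mathrm{ex}_<(n,P_5^{1243})=\Theta(n)$.
   Context: Edge-ordered graph: finite simple graph with a linear order on its edges; isomorphisms preserve order; subgraphs carry induced order; $\mathrm{ex}_<(n,H)$ is the maximum number of edges of an edge-ordered graph on $n$ vertices with no subgraph isomorphic to $H$. Notation: $P_k^{a_1\dots a_{k-1}}$ is the path $v_1\dots v_k$ where edge $v_iv_{i+1}$ has label $a_i$ and edges are ordered by label; e.g. $P_5^{1243}$ has $v_1v_2<v_2v_3<v_4v_5<v_3v_4$. -}

module Defs where

open import Data.Nat using (ℕ; _+_; _*_; _≤_; _≥_)
open import Data.Fin using (Fin; zero; suc; _<_)
open import Data.Fin.Properties using (_≟_)
open import Data.Product using (Σ; _×_; _,_; proj₁; proj₂; ∃-syntax)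
open import Data.Sum using (_⊎_; inj₁; inj₂)
open import Data.List using (List; []; _∷_; length; lookup)
open import Data.List.Relation.Unary.All using (All; all?)
open import Data.List.Relation.Unary.AllPairs using (AllPairs; allPairs?)
open import Relation.Binary.PropositionalEquality using (_≡_; _≢_)
open import Relation.Nullary using (¬_; Dec; yes; no)
open import Relation.Nullary.Decidable using (toWitness; _×-dec_; _⊎-dec_; ¬?)
open import Function.Definitions using (Injective)

Edge : ℕ → Set
Edge n = Fin n × Fin n

SameEdge : ∀ {n} → Edge n → Edge n → Set
SameEdge (a , b) (c , d) = (a ≡ c × b ≡ d) ⊎ (a ≡ d × b ≡ c)

SameEdge? : ∀ {n} (e e' : Edge n) → Dec (SameEdge e e')
SameEdge? (a , b) (c , d) = ((a ≟ c) ×-dec (b ≟ d)) ⊎-dec ((a ≟ d) ×-dec (b ≟ c))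

mapEdge : ∀ {k n} → (Fin k → Fin n) → Edge k → Edge n
mapEdge f (a , b) = f a , f b

-- The edges are listed in increasing order: the linear order on E(G)
-- is "position in the list".
record EOGraph (n : ℕ) : Set where
  field
    edges    : List (Edge n)
    loopless : All (λ e → proj₁ e ≢ proj₂ e) edges
    simple   : AllPairs (λ e e' → ¬ SameEdge e e') edges
open EOGraph public

e : ∀ {n} → EOGraph n → ℕ
e G = length (edges G)

Contains : ∀ {n k} → EOGraph n → EOGraph k → Set
Contains {n} {k} G H =
  Σ (Fin k → Fin n) λ f → Injective _≡_ _≡_ f ×
  Σ (Fin (e H) → Fin (e G)) λ g →
    (∀ i j → i < j → g i < g j) ×
    (∀ i → SameEdge (lookup (edges G) (g i)) (mapEdge f (lookup (edges H) i)))

IsEx : ∀ {k} → ℕ → EOGraph k → ℕ → Set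
IsEx n H m =
  (Σ (EOGraph n) λ G → ¬ Contains G H × e G ≡ m) ×
  (∀ (G : EOGraph n) → ¬ Contains G H → e G ≤ m)

-- ex_<(n, H) = Θ(n): there are constants a/b > 0 (rational, a,b ≥ 1),
-- C, and n₀ such that for all n ≥ n₀, ex_<(n,H) exists and
-- (a/b)·n ≤ ex_<(n,H) ≤ C·n.
ExIsΘn : ∀ {k} → EOGraph k → Set
ExIsΘn H =
  ∃[ a ] ∃[ b ] ∃[ C ] ∃[ n₀ ] (1 ≤ a × 1 ≤ b ×
    (∀ n → n ≥ n₀ → ∃[ m ] (IsEx n H m × a * n ≤ b * m × m ≤ C * n)))

-- Paths P_5 on vertices v₁..v₅ = 0..4, edges listed in increasing order.
private
  v0 v1 v2 v3 v4 : Fin 5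
  v0 = zero
  v1 = suc zero
  v2 = suc (suc zero)
  v3 = suc (suc (suc zero))
  v4 = suc (suc (suc (suc zero)))

  loop? : (e : Edge 5) → Dec (proj₁ e ≢ proj₂ e)
  loop? (a , b) = ¬? (a ≟ b)

  simple? : (es : List (Edge 5)) → Dec (AllPairs (λ e e' → ¬ SameEdge e e') es)
  simple? = allPairs? (λ x y → ¬? (SameEdge? x y))

  edges1234 edges1243 : List (Edge 5)
  edges1234 = (v0 , v1) ∷ (v1 , v2) ∷ (v2 , v3) ∷ (v3 , v4) ∷ []
  edges1243 = (v0 , v1) ∷ (v1 , v2) ∷ (v3 , v4) ∷ (v2 , v3) ∷ []

P5-1234 : EOGraph 5
P5-1234 = record
  { edges = edges1234
  ; loopless = toWitness {a? = all? loop? edges1234} _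
  ; simple = toWitness {a? = simple? edges1234} _ }

P5-1243 : EOGraph 5
P5-1243 = record
  { edges = edges1243
  ; loopless = toWitness {a? = all? loop? edges1243} _
  ; simple = toWitness {a? = simple? edges1243} _ }

-- Both paths have two vertex-disjoint edges, so no star contains them; the star K_{1,n-1} gives
-- ex_<(n, P) ≥ n - 1 ≥ n/2.  For the upper bound, prune the edges in rounds: an edge survives a round
-- when each of its endpoints lies on at least 4 earlier edges that survived the previous round.  Charging
-- a removed edge to an endpoint with fewer than 4 such earlier edges charges every vertex at most 4 times,
-- so a round removes at most 4n edges.  If e(G) > 12n some edge xy survives three rounds, and walking
-- backwards from x through ever earlier edges, each surviving one round fewer and avoiding the at most
-- three vertices already used, yields P_5^{1234}.  If e(G) > 8n some edge xy survives two rounds; take the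
-- earliest once-surviving edge xw at x or y, extend it backwards at w, and extend at y by a once-surviving
-- edge, which by minimality comes after xw: this is P_5^{1243}.  Finally P-freeness is decidable, so
-- ex_<(n, P) exists: it is the largest size, below that bound, of a P-free graph on n vertices.

module Submission where

open import Defs
open import Level using (0ℓ)
open import Data.Nat as ℕ using (ℕ; zero; suc; _+_; _*_; _⊓_; _≤_; _<_; _≥_; z≤n; s≤s; z<s; s<s; _<?_; _≤?_)
open import Data.Nat.Properties as ℕ
  using (≤-refl; ≤-trans; <-≤-trans; <-trans; +-monoʳ-≤; +-mono-≤; ≮⇒≥; m≤n⇒m⊓n≡m)
open import Data.Fin as Fin using (Fin; zero; suc; fromℕ<)
open import Data.Fin.Properties using (_≟_; any?; all?; ¬∀⟶∃¬; toℕ-fromℕ<; suc-injective)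
open import Data.Product using (Σ; ∃; ∃-syntax; _×_; _,_; proj₁; proj₂; uncurry)
open import Data.Sum using (_⊎_; inj₁; inj₂)
open import Data.Empty using (⊥; ⊥-elim)
open import Data.Unit using (tt)
open import Data.List using (List; []; _∷_; lookup; tabulate)
open import Data.List.Properties using (tabulate-cong; tabulate-lookup; length-tabulate)
open import Data.List.Membership.Propositional.Properties using (∈-lookup)
open import Data.List.Relation.Unary.All as All using (All; []; _∷_)
open import Data.List.Relation.Unary.AllPairs as AllPairs using (AllPairs; []; _∷_)
import Data.List.Relation.Unary.All.Properties as All
import Data.List.Relation.Unary.AllPairs.Properties as AllPairs
import Data.Vec.Functional as Vector
open import Data.Vec as Vec using (Vec; []; _∷_)
open import Data.Vec.Relation.Unary.Unique.Propositional using (Unique)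
open import Data.Vec.Relation.Unary.AllPairs using ([]; _∷_)
open import Data.Vec.Relation.Unary.Unique.Propositional.Properties using (lookup-injective)
open import Data.Vec.Relation.Unary.Linked using (Linked; []; [-]; _∷_)
import Data.Vec.Relation.Unary.Linked.Properties as Linked
open import Data.Vec.Relation.Unary.All as VecAll using ([]; _∷_)
open import Relation.Unary using (Pred; Decidable; U; _∩_)
open import Relation.Unary.Properties using (U?; _∩?_; _∪?_; ∁?)
open import Relation.Binary.PropositionalEquality
open import Relation.Nullary using (¬_; Dec; yes; no)
open import Relation.Binary using (tri<; tri≈; tri>)
open import Relation.Nullary.Decidable using (map′; _×-dec_; _→-dec_; ¬?)
open import Function.Definitions using (Injective)
open import Function.Base using (case_of_)

SameEdge-map-cong : ∀ {k n} {f g : Fin k → Fin n} → (∀ i → f i ≡ g i) →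
                    ∀ {d} c → SameEdge d (mapEdge f c) → SameEdge d (mapEdge g c)
SameEdge-map-cong eq (a , b) s rewrite eq a | eq b = s

SameEdge-sym : ∀ {n} {c d : Edge n} → SameEdge c d → SameEdge d c
SameEdge-sym (inj₁ (refl , refl)) = inj₁ (refl , refl)
SameEdge-sym (inj₂ (refl , refl)) = inj₂ (refl , refl)

SameEdge-trans : ∀ {n} {c d f : Edge n} → SameEdge c d → SameEdge d f → SameEdge c f
SameEdge-trans (inj₁ (refl , refl)) s = s
SameEdge-trans (inj₂ (refl , refl)) (inj₁ (refl , refl)) = inj₂ (refl , refl)
SameEdge-trans (inj₂ (refl , refl)) (inj₂ (refl , refl)) = inj₁ (refl , refl)

SameEdge-flip : ∀ {n} {d : Edge n} {v w} → SameEdge d (v , w) → SameEdge d (w , v)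
SameEdge-flip (inj₁ eqs) = inj₂ eqs
SameEdge-flip (inj₂ eqs) = inj₁ eqs

_∈ₑ_ : ∀ {n} → Fin n → Edge n → Set
v ∈ₑ (a , b) = v ≡ a ⊎ v ≡ b

Disjoint : ∀ {n} → Edge n → Edge n → Set
Disjoint c c′ = ∀ {v} → v ∈ₑ c → ¬ v ∈ₑ c′

∈ₑ-SameEdge : ∀ {n} {v : Fin n} {d c} → SameEdge d c → v ∈ₑ d → v ∈ₑ c
∈ₑ-SameEdge (inj₁ (refl , refl)) v∈ = v∈
∈ₑ-SameEdge (inj₂ (refl , refl)) (inj₁ v≡a) = inj₂ v≡a
∈ₑ-SameEdge (inj₂ (refl , refl)) (inj₂ v≡b) = inj₁ v≡b

∈ₑ-mapEdge : ∀ {k n} (f : Fin k → Fin n) {v} c → v ∈ₑ mapEdge f c → ∃[ u ] u ∈ₑ c × v ≡ f u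
∈ₑ-mapEdge f (a , b) (inj₁ v≡fa) = a , inj₁ refl , v≡fa
∈ₑ-mapEdge f (a , b) (inj₂ v≡fb) = b , inj₂ refl , v≡fb

Searchable : Set → Set₁
Searchable A = ∀ {P : Pred A 0ℓ} → Decidable P → Dec (∃ P)

Fin-searchable : ∀ {n} → Searchable (Fin n)
Fin-searchable = any?

×-searchable : ∀ {A B} → Searchable A → Searchable B → Searchable (A × B)
×-searchable search-A search-B P? =
  map′ (λ (a , b , p) → (a , b) , p) (λ ((a , b) , p) → a , b , p)
       (search-A λ a → search-B λ b → P? (a , b))

Extensional : ∀ {A : Set} {k} → Pred (Fin k → A) 0ℓ → Set
Extensional P = ∀ {f g} → (∀ i → f i ≡ g i) → P f → P g

Fin→-searchable : ∀ {A} → Searchable A → ∀ {k} {P : Pred (Fin k → A) 0ℓ} →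
                  Extensional P → Decidable P → Dec (∃ P)
Fin→-searchable search {zero} ext P? =
  map′ (_ ,_) (λ (_ , p) → ext (λ ()) p) (P? (λ ()))
Fin→-searchable search {suc k} ext P? =
  map′ (λ (x , h , p) → x Vector.∷ h , p)
       (λ (f , p) → Vector.head f , Vector.tail f , ext (λ { zero → refl ; (suc i) → refl }) p)
       (search λ x → Fin→-searchable search (λ eq → ext λ { zero → refl ; (suc i) → eq i })
                                             (λ h → P? (x Vector.∷ h)))

Injective? : ∀ {k n} (f : Fin k → Fin n) → Dec (Injective _≡_ _≡_ f)
Injective? f = map′ (λ inj {x} {y} → inj x y) (λ inj x y → inj {x} {y})
                    (all? λ x → all? λ y → (f x ≟ f y) →-dec (x ≟ y))

Contains? : ∀ {n k} (G : EOGraph n) (H : EOGraph k) → Dec (Contains G H)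
Contains? G H = Fin→-searchable Fin-searchable
  (λ eq (inj , g , mono , same) →
     (λ {x} {y} p → inj (trans (eq x) (trans p (sym (eq y))))) ,
     g , mono , λ i → SameEdge-map-cong eq _ (same i))
  (λ f → Injective? f ×-dec Fin→-searchable Fin-searchable
     (λ eq (mono , same) →
        (λ i j i<j → subst₂ Fin._<_ (eq i) (eq j) (mono i j i<j)) ,
        λ i → subst (λ x → SameEdge (lookup (edges G) x) _) (eq i) (same i))
     (λ g → (all? λ i → all? λ j → (i Fin.<? j) →-dec (g i Fin.<? g j)) ×-dec
            all? λ i → SameEdge? _ _))

module _ {k} (H : EOGraph k) where

  FreeEdgeList : ∀ {n} → List (Edge n) → Set
  FreeEdgeList l =
    Σ (All (λ d → proj₁ d ≢ proj₂ d) l) λ lp →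
    Σ (AllPairs (λ d d′ → ¬ SameEdge d d′) l) λ sp →
    ¬ Contains (record { edges = l ; loopless = lp ; simple = sp }) H

  FreeEdgeList? : ∀ {n} (l : List (Edge n)) → Dec (FreeEdgeList l)
  FreeEdgeList? l with All.all? (λ d → ¬? (proj₁ d ≟ proj₂ d)) l
                     | AllPairs.allPairs? (λ d d′ → ¬? (SameEdge? d d′)) l
  ... | no ¬lp | _      = no λ (lp , _) → ¬lp lp
  ... | yes _  | no ¬sp = no λ (_ , sp , _) → ¬sp sp
  ... | yes lp | yes sp =
    map′ (λ nc → lp , sp , nc) (λ (_ , _ , nc) → nc)
         (¬? (Contains? (record { edges = l ; loopless = lp ; simple = sp }) H))

  FreeGraphWith : ℕ → ℕ → Set
  FreeGraphWith n m = Σ (EOGraph n) λ G → ¬ Contains G H × e G ≡ m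

  FreeGraphWith? : ∀ n m → Dec (FreeGraphWith n m)
  FreeGraphWith? n m =
    map′ (λ (h , lp , sp , nc) →
            record { edges = tabulate h ; loopless = lp ; simple = sp } , nc , length-tabulate h)
         (λ { (G , nc , refl) →
              lookup (edges G) ,
              subst FreeEdgeList (sym (tabulate-lookup (edges G))) (loopless G , simple G , nc) })
         (Fin→-searchable (×-searchable Fin-searchable Fin-searchable)
                          (λ eq → subst FreeEdgeList (tabulate-cong eq))
                          (λ h → FreeEdgeList? (tabulate h)))

  empty-free : ∀ {n} → 0 < e H → FreeGraphWith n 0
  empty-free 0<eH =
    record { edges = [] ; loopless = [] ; simple = [] } ,
    (λ (_ , _ , g , _) → no-edge (g (fromℕ< 0<eH))) , refl
    where no-edge : Fin 0 → ⊥
          no-edge ()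

bounded-max : ∀ {P : Pred ℕ 0ℓ} → Decidable P → P 0 → ∀ B →
              ∃[ m ] m ≤ B × P m × (∀ {j} → j ≤ B → P j → j ≤ m)
bounded-max P? p₀ zero = 0 , z≤n , p₀ , λ j≤0 _ → j≤0
bounded-max {P} P? p₀ (suc B) with P? (suc B)
... | yes p = suc B , ≤-refl , p , λ j≤ _ → j≤
... | no ¬p with bounded-max P? p₀ B
...   | m , m≤B , pm , max = m , ℕ.m≤n⇒m≤1+n m≤B , pm , below
  where
  below : ∀ {j} → j ≤ suc B → P j → j ≤ m
  below j≤ pj with ℕ.m≤n⇒m<n∨m≡n j≤
  ... | inj₁ j<  = max (ℕ.≤-pred j<) pj
  ... | inj₂ refl = ⊥-elim (¬p pj)

IsEx-exists : ∀ {k} (H : EOGraph k) → 0 < e H → ∀ n B →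
              (∀ (G : EOGraph n) → ¬ Contains G H → e G ≤ B) → ∃[ m ] IsEx n H m × m ≤ B
IsEx-exists H 0<eH n B bound
  with bounded-max (FreeGraphWith? H n) (empty-free H 0<eH) B
... | m , m≤B , free , max = m , (free , λ G nc → max (bound G nc) (G , nc , refl)) , m≤B

common-vertex⇒¬Contains : ∀ {n k} (G : EOGraph n) (c : Fin n) → All (c ∈ₑ_) (edges G) →
  (H : EOGraph k) (i j : Fin (e H)) → Disjoint (lookup (edges H) i) (lookup (edges H) j) →
  ¬ Contains G H
common-vertex⇒¬Contains G c through H i j disjoint (f , inj , g , _ , same) =
  let (u , u∈i , c≡fu) = preimage i ; (u′ , u′∈j , c≡fu′) = preimage j
  in disjoint u∈i (subst (_∈ₑ _) (inj (trans (sym c≡fu′) c≡fu)) u′∈j)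
  where
  preimage : ∀ i → ∃[ u ] u ∈ₑ lookup (edges H) i × c ≡ f u
  preimage i = ∈ₑ-mapEdge f _ (∈ₑ-SameEdge (same i) (All.lookup through (∈-lookup (g i))))

star : ∀ k → EOGraph (suc k)
star k = record
  { edges    = tabulate λ i → zero , suc i
  ; loopless = All.tabulate⁺ λ _ ()
  ; simple   = AllPairs.tabulate⁺ λ i≢j → λ
      { (inj₁ (_ , si≡sj)) → i≢j (suc-injective si≡sj) ; (inj₂ (() , _)) } }

star-size : ∀ k → e (star k) ≡ k
star-size k = length-tabulate λ i → zero , suc i

star-centred : ∀ k → All (zero ∈ₑ_) (edges (star k))
star-centred k = All.tabulate⁺ λ _ → inj₁ refl

n≤2*[n-1] : ∀ {k m} → suc k ≤ m → 1 * suc (suc k) ≤ 2 * m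
n≤2*[n-1] {k} {m} k<m = begin
  1 * suc (suc k) ≡⟨ ℕ.*-identityˡ _ ⟩
  suc (suc k)     ≤⟨ s≤s k<m ⟩
  suc m           ≡⟨ ℕ.+-comm 1 m ⟩
  m + 1           ≤⟨ +-monoʳ-≤ m (≤-trans (s≤s z≤n) k<m) ⟩
  m + m           ≡⟨ cong (m +_) (sym (ℕ.+-identityʳ m)) ⟩
  2 * m           ∎
  where open ℕ.≤-Reasoning

ExIsΘn-intro : ∀ {k} (H : EOGraph k) (C : ℕ) → 0 < e H →
  (i j : Fin (e H)) → Disjoint (lookup (edges H) i) (lookup (edges H) j) →
  (∀ n (G : EOGraph n) → ¬ Contains G H → e G ≤ C * n) → ExIsΘn H
ExIsΘn-intro H C 0<eH i j disjoint bound = 1 , 2 , C , 2 , s≤s z≤n , s≤s z≤n , Θ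
  where
  Θ : ∀ n → n ≥ 2 → ∃[ m ] IsEx n H m × 1 * n ≤ 2 * m × m ≤ C * n
  Θ n@(suc (suc k)) (s≤s (s≤s z≤n)) =
    let (m , isEx@(_ , maximal) , m≤Cn) = IsEx-exists H 0<eH n (C * n) (bound n)
        star-free = common-vertex⇒¬Contains (star (suc k)) zero (star-centred (suc k)) H i j disjoint
    in m , isEx , n≤2*[n-1] (subst (_≤ m) (star-size (suc k)) (maximal (star (suc k)) star-free)) , m≤Cn

module _ {P : Pred ℕ 0ℓ} (P? : Decidable P) where

  count : ℕ → ℕ
  count zero = 0
  count (suc M) with P? M
  ... | yes _ = suc (count M)
  ... | no _  = count M

  count-≤-suc : ∀ M → count M ≤ count (suc M)
  count-≤-suc M with P? M
  ... | yes _ = ℕ.n≤1+n _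
  ... | no _  = ≤-refl

  count-suc : ∀ {M} → P M → count (suc M) ≡ suc (count M)
  count-suc {M} p with P? M
  ... | yes _ = refl
  ... | no ¬p = ⊥-elim (¬p p)

  count-all : (∀ j → P j) → ∀ M → count M ≡ M
  count-all all zero = refl
  count-all all (suc M) = trans (count-suc (all M)) (cong suc (count-all all M))

  count-first : ∀ {M} → 0 < count M → ∃[ j ] j < M × P j × count j ≡ 0
  count-first {suc M} pos with P? M
  ... | no _ = let (j , j<M , rest) = count-first pos in j , ℕ.m<n⇒m<1+n j<M , rest
  ... | yes p with count M in eq
  ...   | zero  = M , ≤-refl , p , eq
  ...   | suc _ = let (j , j<M , rest) = count-first (subst (0 <_) (sym eq) (s≤s z≤n))
                  in j , ℕ.m<n⇒m<1+n j<M , rest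

  count≡0⇒¬ : ∀ {j k} → count j ≡ 0 → k < j → ¬ P k
  count≡0⇒¬ {suc j} {k} none k<1+j pk with P? j | ℕ.m≤n⇒m<n∨m≡n k<1+j
  ... | no _  | inj₁ k<j = count≡0⇒¬ none (ℕ.≤-pred k<j) pk
  ... | no ¬p | inj₂ refl = ¬p pk

  count-≤1 : (∀ {j j′} → j < j′ → P j → ¬ P j′) → ∀ M → count M ≤ 1
  count-≤1 unique zero = z≤n
  count-≤1 unique (suc M) with P? M
  ... | no _  = count-≤1 unique M
  ... | yes p = s≤s (≮⇒≥ λ pos → let (j , j<M , pj , _) = count-first pos in unique j<M pj p)

module _ {P Q : Pred ℕ 0ℓ} (P? : Decidable P) (Q? : Decidable Q) where

  count-mono : (∀ {j} → P j → Q j) → ∀ M → count P? M ≤ count Q? M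
  count-mono P⊆Q zero = z≤n
  count-mono P⊆Q (suc M) with P? M
  ... | yes p = ≤-trans (s≤s (count-mono P⊆Q M)) (ℕ.≤-reflexive (sym (count-suc Q? (P⊆Q p))))
  ... | no _  = ≤-trans (count-mono P⊆Q M) (count-≤-suc Q? M)

  count-≤-by-potential : (Φ : ℕ → ℕ) → (∀ M → Φ M ≤ Φ (suc M)) →
    (∀ {M} → P M → ¬ Q M → Φ M < Φ (suc M)) → ∀ M → count P? M ≤ count Q? M + Φ M
  count-≤-by-potential Φ mono lost zero = z≤n
  count-≤-by-potential Φ mono lost (suc M)
    with P? M | Q? M | count-≤-by-potential Φ mono lost M
  ... | yes _ | yes _ | IH = s≤s (≤-trans IH (+-monoʳ-≤ _ (mono M)))
  ... | yes p | no ¬q | IH = begin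
    suc (count P? M)           ≤⟨ s≤s IH ⟩
    suc (count Q? M + Φ M)     ≡⟨ sym (ℕ.+-suc _ _) ⟩
    count Q? M + suc (Φ M)     ≤⟨ +-monoʳ-≤ _ (lost p ¬q) ⟩
    count Q? M + Φ (suc M)     ∎
    where open ℕ.≤-Reasoning
  ... | no _  | yes _ | IH = ≤-trans IH (+-mono-≤ (ℕ.n≤1+n _) (mono M))
  ... | no _  | no _  | IH = ≤-trans IH (+-monoʳ-≤ _ (mono M))

count-subadditive : ∀ {P Q R : Pred ℕ 0ℓ} (P? : Decidable P) (Q? : Decidable Q) (R? : Decidable R) →
  (∀ {j} → P j → Q j ⊎ R j) → ∀ M → count P? M ≤ count Q? M + count R? M
count-subadditive P? Q? R? cover =
  count-≤-by-potential P? Q? (count R?) (count-≤-suc R?) λ p ¬q → case cover p of λ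
    { (inj₁ q) → ⊥-elim (¬q q)
    ; (inj₂ r) → ℕ.≤-reflexive (sym (count-suc R? r)) }

∑ : ∀ {n} → (Fin n → ℕ) → ℕ
∑ {zero}  f = 0
∑ {suc n} f = f zero + ∑ (λ i → f (suc i))

∑-mono-≤ : ∀ {n} {f g : Fin n → ℕ} → (∀ i → f i ≤ g i) → ∑ f ≤ ∑ g
∑-mono-≤ {zero}  f≤g = z≤n
∑-mono-≤ {suc n} f≤g = +-mono-≤ (f≤g zero) (∑-mono-≤ (λ i → f≤g (suc i)))

∑-mono-< : ∀ {n} {f g : Fin n → ℕ} → (∀ i → f i ≤ g i) → ∀ i → f i < g i → ∑ f < ∑ g
∑-mono-< f≤g zero    f<g = +-mono-≤ f<g (∑-mono-≤ (λ i → f≤g (suc i)))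
∑-mono-< f≤g (suc i) f<g =
  ≤-trans (ℕ.≤-reflexive (sym (ℕ.+-suc _ _))) (+-mono-≤ (f≤g zero) (∑-mono-< (λ i → f≤g (suc i)) i f<g))

∑-≤-* : ∀ {n} {f : Fin n → ℕ} c → (∀ i → f i ≤ c) → ∑ f ≤ n * c
∑-≤-* {zero}  c f≤c = z≤n
∑-≤-* {suc n} c f≤c = +-mono-≤ (f≤c zero) (∑-≤-* c (λ i → f≤c (suc i)))

allPairs-lookup : ∀ {A : Set} {R : A → A → Set} {xs : List A} → AllPairs R xs →
                  ∀ {i j} → i Fin.< j → R (lookup xs i) (lookup xs j)
allPairs-lookup (rx ∷ _)  {zero}  {suc j} _   = All.lookup rx (∈-lookup j)
allPairs-lookup (_ ∷ rxs) {suc i} {suc j} i<j = allPairs-lookup rxs (ℕ.s<s⁻¹ i<j)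

fromℕ<-mono : ∀ {i j m} (i<m : i < m) (j<m : j < m) → i < j → fromℕ< i<m Fin.< fromℕ< j<m
fromℕ<-mono i<m j<m = subst₂ _<_ (sym (toℕ-fromℕ< i<m)) (sym (toℕ-fromℕ< j<m))

module Positions {n} (G : EOGraph n) where

  edgeAt : ∀ {j} → j < e G → Edge n
  edgeAt j<m = lookup (edges G) (fromℕ< j<m)

  Joins : ℕ → Fin n → Fin n → Set
  Joins j v w = Σ (j < e G) λ j<m → SameEdge (edgeAt j<m) (v , w)

  Joins? : ∀ j v w → Dec (Joins j v w)
  Joins? j v w with j <? e G
  ... | yes j<m = map′ (j<m ,_) proj₂ (SameEdge? (edgeAt j<m) (v , w))
  ... | no  j≮m = no λ (j<m , _) → j≮m j<m

  Incident : Fin n → Pred ℕ 0ℓ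
  Incident v j = ∃ (Joins j v)

  Incident? : ∀ v → Decidable (Incident v)
  Incident? v j = any? (Joins? j v)

  edge-at : ∀ {j} → j < e G → ∃[ v ] ∃[ w ] Joins j v w
  edge-at j<m = _ , _ , j<m , inj₁ (refl , refl)

  Joins-sym : ∀ {j v w} → Joins j v w → Joins j w v
  Joins-sym (j<m , s) = j<m , SameEdge-flip s

  Joins⇒≢ : ∀ {j v w} → Joins j v w → v ≢ w
  Joins⇒≢ (j<m , s) = loop s (All.lookup (loopless G) (∈-lookup (fromℕ< j<m)))
    where
    loop : ∀ {d : Edge n} {v w} → SameEdge d (v , w) → proj₁ d ≢ proj₂ d → v ≢ w
    loop (inj₁ (refl , refl)) a≢b = a≢b
    loop (inj₂ (refl , refl)) a≢b = λ v≡w → a≢b (sym v≡w)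

  Joins-once : ∀ {j j′ v w} → j < j′ → Joins j v w → ¬ Joins j′ v w
  Joins-once j<j′ (j<m , s) (j′<m , s′) =
    allPairs-lookup (simple G) (fromℕ<-mono j<m j′<m j<j′) (SameEdge-trans s (SameEdge-sym s′))

  Joins-endpoint : ∀ {j a b c d} → Joins j a b → Joins j c d → c ≢ a → c ≡ b
  Joins-endpoint (_ , s) (_ , s′) c≢a
    with ∈ₑ-SameEdge s (∈ₑ-SameEdge (SameEdge-sym s′) (inj₁ refl))
  ... | inj₁ c≡a = ⊥-elim (c≢a c≡a)
  ... | inj₂ c≡b = c≡b

  Contains-intro : ∀ {k} (H : EOGraph k) (ws : Vec (Fin n) k) → Unique ws →
    (ps : Vec ℕ (e H)) → Linked _<_ ps →
    (∀ i → uncurry (Joins (Vec.lookup ps i)) (mapEdge (Vec.lookup ws) (lookup (edges H) i))) →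
    Contains G H
  Contains-intro H ws distinct ps increasing joins =
    Vec.lookup ws , (λ {x} {y} → lookup-injective distinct x y) ,
    (λ i → fromℕ< (proj₁ (joins i))) ,
    (λ i j i<j → fromℕ<-mono (proj₁ (joins i)) (proj₁ (joins j)) (Linked.lookup⁺ <-trans increasing i<j)) ,
    (λ i → proj₂ (joins i))

  neighbour-avoiding : ∀ {P : Pred ℕ 0ℓ} (P? : Decidable P) {v} → (∀ {j} → P j → Incident v j) →
    ∀ {i k} (xs : Vec (Fin n) k) → k < count P? i →
    ∃[ j ] ∃[ w ] j < i × P j × Joins j v w × VecAll.All (w ≢_) xs
  neighbour-avoiding P? incident [] pos =
    let (j , j<i , p , _) = count-first P? pos ; (w , vw) = incident p
    in j , w , j<i , p , vw , []
  neighbour-avoiding P? {v} incident {i} (s ∷ xs) 1+k<count =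
    let (j , w , j<i , (p , ¬vs) , vw , w∉xs) = neighbour-avoiding (P? ∩? ∁? Joins-s?) (λ (p , _) → incident p) xs k<count′
    in j , w , j<i , p , vw , (λ w≡s → ¬vs (subst (Joins j v) w≡s vw)) ∷ w∉xs
    where
    Joins-s? : Decidable (λ j → Joins j v s)
    Joins-s? j = Joins? j v s
    at-most-once : count Joins-s? i ≤ 1
    at-most-once = count-≤1 Joins-s? Joins-once i
    split : count P? i ≤ count (P? ∩? ∁? Joins-s?) i + count Joins-s? i
    split = count-subadditive P? (P? ∩? ∁? Joins-s?) Joins-s?
              (λ {j} p → case Joins-s? j of λ { (yes vs) → inj₂ vs ; (no ¬vs) → inj₁ (p , ¬vs) }) i
    k<count′ : _ < count (P? ∩? ∁? Joins-s?) i
    k<count′ = ℕ.≤-pred (≤-trans 1+k<count (≤-trans split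
                 (≤-trans (+-monoʳ-≤ _ at-most-once) (ℕ.≤-reflexive (ℕ.+-comm _ 1)))))

m<d⇒m⊓d<1+m⊓d : ∀ {m d} → m < d → m ⊓ d < suc m ⊓ d
m<d⇒m⊓d<1+m⊓d {m} {d} m<d = subst₂ _<_ (sym (m≤n⇒m⊓n≡m (ℕ.<⇒≤ m<d))) (sym (m≤n⇒m⊓n≡m m<d)) ≤-refl

module Pruning {n} (G : EOGraph n) (d : ℕ) where
  open Positions G

  -- Opaque because Kept? (suc r) mentions Kept? r twice: unfolded, the types grow exponentially in r.
  opaque
    mutual
      Kept : ℕ → Pred ℕ 0ℓ
      Kept zero    = U
      Kept (suc r) = Kept r ∩ Rich r

      Rich : ℕ → Pred ℕ 0ℓ
      Rich r j = ∀ v → Incident v j → d ≤ count (Kept? r ∩? Incident? v) j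

      Kept? : ∀ r → Decidable (Kept r)
      Kept? zero    = U?
      Kept? (suc r) = Kept? r ∩? Rich? r

      Rich? : ∀ r → Decidable (Rich r)
      Rich? r j = all? λ v → Incident? v j →-dec d ≤? count (Kept? r ∩? Incident? v) j

  degreeBefore : ℕ → Fin n → ℕ → ℕ
  degreeBefore r v = count (Kept? r ∩? Incident? v)

  opaque
    unfolding Kept

    kept-zero : ∀ j → Kept 0 j
    kept-zero _ = tt

    kept-rich : ∀ {r j v} → Kept (suc r) j → Incident v j → d ≤ degreeBefore r v j
    kept-rich (_ , rich) = rich _

    kept-dropped : ∀ {r j} → Kept r j → ¬ Kept (suc r) j → ∃[ v ] Incident v j × degreeBefore r v j < d
    kept-dropped {r} {j} kept ¬kept′ with ¬∀⟶∃¬ n _ (λ v → Incident? v j →-dec d ≤? degreeBefore r v j)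
                                                    (λ rich → ¬kept′ (kept , rich))
    ... | v , ¬rich with Incident? v j
    ...   | yes inc = v , inc , ℕ.≰⇒> λ d≤deg → ¬rich λ _ → d≤deg
    ...   | no ¬inc = ⊥-elim (¬rich λ inc → ⊥-elim (¬inc inc))

  pruning-loss : ∀ r M → count (Kept? r) M ≤ count (Kept? (suc r)) M + n * d
  pruning-loss r M =
    ≤-trans (count-≤-by-potential (Kept? r) (Kept? (suc r)) Φ Φ-mono lost M)
            (+-monoʳ-≤ _ (∑-≤-* d λ v → ℕ.m⊓n≤n (degreeBefore r v M) d))
    where
    degree-mono : ∀ v M → degreeBefore r v M ≤ degreeBefore r v (suc M)
    degree-mono v = count-≤-suc (Kept? r ∩? Incident? v)
    Φ : ℕ → ℕ
    Φ M = ∑ λ v → degreeBefore r v M ⊓ d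
    Φ-mono : ∀ M → Φ M ≤ Φ (suc M)
    Φ-mono M = ∑-mono-≤ λ v → ℕ.⊓-monoˡ-≤ d (degree-mono v M)
    lost : ∀ {M} → Kept r M → ¬ Kept (suc r) M → Φ M < Φ (suc M)
    lost {M} kept ¬kept′ =
      let (v , inc , low) = kept-dropped kept ¬kept′
      in ∑-mono-< (λ v → ℕ.⊓-monoˡ-≤ d (degree-mono v M)) v
           (subst (λ x → degreeBefore r v M ⊓ d < x ⊓ d)
                  (sym (count-suc (Kept? r ∩? Incident? v) (kept , inc)))
                  (m<d⇒m⊓d<1+m⊓d low))

  survivors : ∀ r M → M ≤ count (Kept? r) M + r * (n * d)
  survivors zero M = ℕ.≤-reflexive (sym (trans (ℕ.+-identityʳ _) (count-all (Kept? 0) kept-zero M)))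
  survivors (suc r) M = begin
    M                                                   ≤⟨ survivors r M ⟩
    count (Kept? r) M + r * (n * d)                     ≤⟨ ℕ.+-monoˡ-≤ _ (pruning-loss r M) ⟩
    count (Kept? (suc r)) M + n * d + r * (n * d)       ≡⟨ ℕ.+-assoc (count (Kept? (suc r)) M) (n * d) _ ⟩
    count (Kept? (suc r)) M + suc r * (n * d)           ∎
    where open ℕ.≤-Reasoning

  kept-exists : ∀ r → r * d * n < e G → ∃[ j ] j < e G × Kept r j
  kept-exists r many = let (j , j<m , kept , _) = count-first (Kept? r) positive in j , j<m , kept
    where
    many′ : r * (n * d) < e G
    many′ = subst (_< e G) (trans (ℕ.*-assoc r d n) (cong (r *_) (ℕ.*-comm d n))) many
    positive : 0 < count (Kept? r) (e G)
    positive = ℕ.≰⇒> λ none → ℕ.<⇒≱ many′ (≤-trans (survivors r (e G)) (ℕ.+-monoˡ-≤ _ none))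

  earlier-neighbour : ∀ {r j v u k} → Kept (suc r) j → Joins j v u → (xs : Vec (Fin n) k) → k < d →
    ∃[ j′ ] ∃[ w ] j′ < j × Kept r j′ × Joins j′ v w × VecAll.All (w ≢_) (v ∷ xs)
  earlier-neighbour {r} {v = v} kept vu xs k<d =
    let (j′ , w , j′<j , (kept′ , _) , vw , w∉xs) =
          neighbour-avoiding (Kept? r ∩? Incident? v) proj₂ xs (<-≤-trans k<d (kept-rich kept (_ , vu)))
    in j′ , w , j′<j , kept′ , vw , ≢-sym (Joins⇒≢ vw) ∷ w∉xs

module _ {n} (G : EOGraph n) where
  open Positions G
  open Pruning G 4

  many-edges⇒P5-1234 : 12 * n < e G → Contains G P5-1234
  many-edges⇒P5-1234 many =
    case kept-exists 3 many of λ (i , i<m , kept₃) →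
    case edge-at i<m of λ (x , y , xy) →
    case earlier-neighbour kept₃ xy (y ∷ []) (s<s z<s) of λ
      (j₃ , w₃ , j₃<i , kept₂ , xw₃ , w₃∉) →
    case earlier-neighbour kept₂ (Joins-sym xw₃) (x ∷ y ∷ []) (s<s (s<s z<s)) of λ
      (j₂ , w₂ , j₂<j₃ , kept₁ , w₃w₂ , w₂∉) →
    case earlier-neighbour kept₁ (Joins-sym w₃w₂) (w₃ ∷ x ∷ y ∷ []) (s<s (s<s (s<s z<s))) of λ
      (j₁ , w₁ , j₁<j₂ , _ , w₂w₁ , w₁∉) →
    Contains-intro P5-1234 (w₁ ∷ w₂ ∷ w₃ ∷ x ∷ y ∷ [])
      (w₁∉ ∷ w₂∉ ∷ w₃∉ ∷ (Joins⇒≢ xy ∷ []) ∷ [] ∷ [])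
      (j₁ ∷ j₂ ∷ j₃ ∷ i ∷ []) (j₁<j₂ ∷ j₂<j₃ ∷ j₃<i ∷ [-])
      λ { zero → Joins-sym w₂w₁ ; (suc zero) → Joins-sym w₃w₂
        ; (suc (suc zero)) → Joins-sym xw₃ ; (suc (suc (suc zero))) → xy }

  earliest-neighbour⇒P5-1243 : ∀ {i j₀ x y w₂} → Kept 2 i → Joins i x y →
    j₀ < i → Kept 1 j₀ → Joins j₀ x w₂ → (∀ {j} → j < j₀ → Kept 1 j → ¬ Incident y j) →
    Contains G P5-1243
  earliest-neighbour⇒P5-1243 {i} {j₀} {x} {y} {w₂} kept₂ xy j₀<i kept₁ xw₂ first =
    case earlier-neighbour kept₁ (Joins-sym xw₂) (x ∷ y ∷ []) (s<s (s<s z<s)) of λ where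
      (j₁ , w₁ , j₁<j₀ , _ , w₂w₁ , w₁≢w₂ ∷ w₁≢x ∷ w₁≢y ∷ []) →
        case earlier-neighbour kept₂ (Joins-sym xy) (x ∷ w₂ ∷ w₁ ∷ []) (s<s (s<s (s<s z<s))) of λ where
          (j₃ , w₄ , j₃<i , kept₁′ , yw₄ , w₄≢y ∷ w₄≢x ∷ w₄≢w₂ ∷ w₄≢w₁ ∷ []) →
            Contains-intro P5-1243 (w₁ ∷ w₂ ∷ x ∷ y ∷ w₄ ∷ [])
              ((w₁≢w₂ ∷ w₁≢x ∷ w₁≢y ∷ ≢-sym w₄≢w₁ ∷ []) ∷
               (≢-sym (Joins⇒≢ xw₂) ∷ w₂≢y ∷ ≢-sym w₄≢w₂ ∷ []) ∷
               (Joins⇒≢ xy ∷ ≢-sym w₄≢x ∷ []) ∷ (≢-sym w₄≢y ∷ []) ∷ [] ∷ [])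
              (j₁ ∷ j₀ ∷ j₃ ∷ i ∷ []) (j₁<j₀ ∷ after-first kept₁′ yw₄ ∷ j₃<i ∷ [-])
              λ { zero → Joins-sym w₂w₁ ; (suc zero) → Joins-sym xw₂
                ; (suc (suc zero)) → yw₄ ; (suc (suc (suc zero))) → xy }
    where
    w₂≢y : w₂ ≢ y
    w₂≢y w₂≡y = Joins-once j₀<i (subst (Joins j₀ x) w₂≡y xw₂) xy
    after-first : ∀ {j w} → Kept 1 j → Joins j y w → j₀ < j
    after-first {j} kept yw with ℕ.<-cmp j j₀
    ... | tri< j<j₀ _ _ = ⊥-elim (first j<j₀ kept (_ , yw))
    ... | tri≈ _ refl _ = ⊥-elim (w₂≢y (sym (Joins-endpoint xw₂ yw (≢-sym (Joins⇒≢ xy)))))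
    ... | tri> _ _ j₀<j = j₀<j

  twice-kept⇒P5-1243 : ∀ {i x y} → Kept 2 i → Joins i x y → Contains G P5-1243
  twice-kept⇒P5-1243 {i} {x} {y} kept₂ xy =
    case count-first (Kept? 1 ∩? (Incident? x ∪? Incident? y)) kept-at-x-before of λ where
      (j₀ , j₀<i , (kept₁ , inj₁ (_ , xw₂)) , none-before) →
        earliest-neighbour⇒P5-1243 kept₂ xy j₀<i kept₁ xw₂
          λ j<j₀ kept at-y → count≡0⇒¬ _ none-before j<j₀ (kept , inj₂ at-y)
      (j₀ , j₀<i , (kept₁ , inj₂ (_ , yw₂)) , none-before) →
        earliest-neighbour⇒P5-1243 kept₂ (Joins-sym xy) j₀<i kept₁ yw₂
          λ j<j₀ kept at-x → count≡0⇒¬ _ none-before j<j₀ (kept , inj₁ at-x)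
    where
    kept-at-x-before : 0 < count (Kept? 1 ∩? (Incident? x ∪? Incident? y)) i
    kept-at-x-before = <-≤-trans (s≤s z≤n) (≤-trans (kept-rich kept₂ (y , xy))
      (count-mono (Kept? 1 ∩? Incident? x) (Kept? 1 ∩? (Incident? x ∪? Incident? y))
                  (λ (kept , at-x) → kept , inj₁ at-x) i))

  many-edges⇒P5-1243 : 8 * n < e G → Contains G P5-1243
  many-edges⇒P5-1243 many =
    case kept-exists 2 many of λ (i , i<m , kept₂) →
    case edge-at i<m of λ (_ , _ , xy) →
    twice-kept⇒P5-1243 kept₂ xy

proposition4p9 : ExIsΘn P5-1234 × ExIsΘn P5-1243
proposition4p9 =
  ExIsΘn-intro P5-1234 12 (s≤s z≤n) zero (suc (suc zero)) v₀v₁∩v₂v₃=∅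
    (λ n G free → ≮⇒≥ λ many → free (many-edges⇒P5-1234 G many)) ,
  ExIsΘn-intro P5-1243 8 (s≤s z≤n) zero (suc (suc zero)) v₀v₁∩v₃v₄=∅
    (λ n G free → ≮⇒≥ λ many → free (many-edges⇒P5-1243 G many))
  where
  v₀v₁∩v₂v₃=∅ : Disjoint (lookup (edges P5-1234) zero) (lookup (edges P5-1234) (suc (suc zero)))
  v₀v₁∩v₂v₃=∅ (inj₁ refl) (inj₁ ())
  v₀v₁∩v₂v₃=∅ (inj₁ refl) (inj₂ ())
  v₀v₁∩v₂v₃=∅ (inj₂ refl) (inj₁ ())
  v₀v₁∩v₂v₃=∅ (inj₂ refl) (inj₂ ())
  v₀v₁∩v₃v₄=∅ : Disjoint (lookup (edges P5-1243) zero) (lookup (edges P5-1243) (suc (suc zero)))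
  v₀v₁∩v₃v₄=∅ (inj₁ refl) (inj₁ ())
  v₀v₁∩v₃v₄=∅ (inj₁ refl) (inj₂ ())
  v₀v₁∩v₃v₄=∅ (inj₂ refl) (inj₁ ())
  v₀v₁∩v₃v₄=∅ (inj₂ refl) (inj₂ ())
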